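{- In a type theory with propositional truncations, weak excluded middle holds if and only if there exist a function $f:\prod_{X:\mathcal{U}}X\to\mathbf{2}$ that is invariant under equivalence, types $X,Y:\mathcal{U}$ and points $x:X$, $y:Y$ such that $f_X(x)\neq f_Y(y)$ and such that the identity types $x=x$ and $y=y$ are propositions.
   Context: Work in intensional Martin-Löf type theory with $\Pi$-, $\Sigma$-, identity, finite types and natural numbers, and a universe $\mathcal{U}$ closed under these, extended with propositional truncations (for each type $A$ a proposition $\|A\|$ with a map $A\to\|A\|$, universal among maps from $A$ into propositions). $=$ is the identity type, $\neg A$ is $A\to\mathbf{0}$, $a\neq b$ is $\neg(a=b)$, $f_X$ abbreviates $f(X)$. A type is a proposition if any two of its elements are equal. Weak excluded middle: for all $A:\mathcal{U}$, $\neg A+\neg\neg A$. An equivalence is a map with a left and a right inverse. $f$ is invariant under equivalence if $f_Y(e(x))=f_X(x)$ for all $X,Y:\mathcal{U}$, equivalences $e:X\to Y$ and $x:X$. -}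

{-# OPTIONS --without-K #-}
module Defs where

open import Level using (Level; Setω)
open import Data.Bool using (Bool)
open import Data.Empty using (⊥)
open import Data.Sum using (_⊎_)
open import Data.Product using (Σ; _×_)
open import Relation.Binary.PropositionalEquality using (_≡_)
open import Relation.Nullary using (¬_)

isProp : ∀ {ℓ} → Set ℓ → Set ℓ
isProp A = (a b : A) → a ≡ b

-- Propositional truncations (as an assumed extension of the type theory):
-- for each type A a proposition ∥ A ∥ with a map A → ∥ A ∥, universal among
-- maps from A into propositions.
record PropTrunc : Setω where
  field
    ∥_∥       : ∀ {ℓ} → Set ℓ → Set ℓ
    ∥∥-isProp : ∀ {ℓ} {A : Set ℓ} → isProp ∥ A ∥
    ∣_∣       : ∀ {ℓ} {A : Set ℓ} → A → ∥ A ∥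
    ∥∥-rec    : ∀ {ℓ ℓ'} {A : Set ℓ} {P : Set ℓ'} → isProp P → (A → P) → ∥ A ∥ → P

WEM : Set₁
WEM = (A : Set) → ¬ A ⊎ ¬ ¬ A

isEquiv : {X Y : Set} → (X → Y) → Set
isEquiv {X} {Y} e = (Σ (Y → X) λ g → (x : X) → g (e x) ≡ x)
                  × (Σ (Y → X) λ h → (y : Y) → e (h y) ≡ y)

InvariantUnderEquiv : ((X : Set) → X → Bool) → Set₁
InvariantUnderEquiv f =
  (X Y : Set) (e : X → Y) → isEquiv e → (x : X) → f Y (e x) ≡ f X x

{-# OPTIONS --without-K #-}
-- (⇒) With WEM, let f X x decide (weakly) whether X has a point other than x.
--     Equivalences preserve this property, and it separates tt : ⊤ from
--     true : Bool; both types have decidable equality, hence UIP.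
--
-- (⇐) As Bool has two values, one of the separated points, say x : X,
--     satisfies f X x ≢ f ⊤ tt.  For a type A put
--         Z = Σ (x' : X), ∥ (x' ≡ x) ⊎ A ∥,   z = (x , ∣ inj₁ refl ∣).
--     If A holds, X → Z, x' ↦ (x' , ∣ inj₂ a ∣) is an equivalence, so
--     f Z z ≡ f X x.  If ¬ A, Z is a singleton (this uses that all paths into x
--     form propositions), so f Z z ≡ f ⊤ tt.  Deciding f Z z ≟ f ⊤ tt in Bool
--     therefore yields ¬ A or ¬ ¬ A.
module Submission where

open import Defs
open import Data.Bool using (Bool; true; false)
open import Data.Bool.Properties using (_≟_)
open import Data.Unit using (⊤; tt)
open import Data.Unit.Properties using () renaming (_≟_ to _≟⊤_)
open import Data.Empty using (⊥-elim)
open import Data.Sum using (_⊎_; inj₁; inj₂)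
open import Data.Product using (Σ; _×_; _,_; proj₁)
open import Relation.Nullary using (¬_; Dec; yes; no)
open import Relation.Binary.PropositionalEquality
  using (_≡_; _≢_; refl; sym; trans; cong; module ≡-Reasoning)
open import Axiom.UniquenessOfIdentityProofs using (module Decidable⇒UIP)

-- If the loops at x form a proposition, so does every path type x' ≡ x:
-- two paths p, q : x' ≡ x differ by the loop (sym p ∙ q), which must be refl.
loops-prop⇒paths-prop : {X : Set} {x : X} → isProp (x ≡ x) → (x' : X) → isProp (x' ≡ x)
loops-prop⇒paths-prop {X} {x} loops-prop x' p q = paths-equal p q (loops-prop (trans (sym p) q) refl)
  where
  paths-equal : {a b : X} (p q : a ≡ b) → trans (sym p) q ≡ refl → p ≡ q
  paths-equal refl q loop-trivial = sym loop-trivial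

Σ-prop-path : {X : Set} {B : X → Set} → ((a : X) → isProp (B a)) →
              {a a' : X} → a ≡ a' → (s : B a) (s' : B a') →
              _≡_ {A = Σ X B} (a , s) (a' , s')
Σ-prop-path B-prop refl s s' = cong (_ ,_) (B-prop _ s s')

left-inverse⇒injective : {X Y : Set} {e : X → Y} (g : Y → X) → ((x : X) → g (e x) ≡ x) →
                         {x x' : X} → e x ≡ e x' → x ≡ x'
left-inverse⇒injective {e = e} g g∘e≡id {x} {x'} p = begin
  x         ≡⟨ sym (g∘e≡id x) ⟩
  g (e x)   ≡⟨ cong g p ⟩
  g (e x')  ≡⟨ g∘e≡id x' ⟩
  x'        ∎
  where open ≡-Reasoning

section-isEquiv : {X : Set} {B : X → Set} → ((a : X) → isProp (B a)) →
                  (s : (a : X) → B a) → isEquiv {X} {Σ X B} (λ a → a , s a)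
section-isEquiv B-prop s =
  (proj₁ , λ _ → refl) , (proj₁ , λ { (a , t) → Σ-prop-path B-prop refl (s a) t })

singleton-isEquiv : {Z : Set} (z : Z) → ((w : Z) → z ≡ w) → isEquiv {⊤} {Z} (λ _ → z)
singleton-isEquiv z centre = ((λ _ → tt) , λ _ → refl) , ((λ _ → tt) , centre)

separated⇒differs-from : {a c : Bool} (b : Bool) → a ≢ c → (a ≢ b) ⊎ (c ≢ b)
separated⇒differs-from {a} {c} b a≢c with a ≟ b
... | no a≢b = inj₁ a≢b
... | yes a≡b = inj₂ (λ c≡b → a≢c (trans a≡b (sym c≡b)))

Separation : Set₁
Separation = Σ ((X : Set) → X → Bool) λ f → InvariantUnderEquiv f ×
             Σ Set λ X → Σ Set λ Y → Σ X λ x → Σ Y λ y →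
             (f X x ≢ f Y y) × isProp (x ≡ x) × isProp (y ≡ y)

weakDecision : {A : Set} → ¬ A ⊎ ¬ ¬ A → Bool
weakDecision (inj₁ _) = false
weakDecision (inj₂ _) = true

weakDecision-empty : {A : Set} → ¬ A → (d : ¬ A ⊎ ¬ ¬ A) → weakDecision d ≡ false
weakDecision-empty ¬a (inj₁ _)   = refl
weakDecision-empty ¬a (inj₂ ¬¬a) = ⊥-elim (¬¬a ¬a)

weakDecision-inhabited : {A : Set} → A → (d : ¬ A ⊎ ¬ ¬ A) → weakDecision d ≡ true
weakDecision-inhabited a (inj₁ ¬a) = ⊥-elim (¬a a)
weakDecision-inhabited a (inj₂ _)  = refl

weakDecision-⇔ : {A B : Set} → (A → B) → (B → A) →
                 (d : ¬ A ⊎ ¬ ¬ A) (d' : ¬ B ⊎ ¬ ¬ B) → weakDecision d' ≡ weakDecision d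
weakDecision-⇔ a→b b→a (inj₁ ¬a)  d'         = weakDecision-empty (λ b → ¬a (b→a b)) d'
weakDecision-⇔ a→b b→a (inj₂ ¬¬a) (inj₁ ¬b) = ⊥-elim (¬¬a (λ a → ¬b (a→b a)))
weakDecision-⇔ a→b b→a (inj₂ ¬¬a) (inj₂ _)  = refl

HasOtherPoint : (X : Set) → X → Set
HasOtherPoint X x = Σ X λ y → y ≢ x

HasOtherPoint-transport : {X Y : Set} (e : X → Y) → isEquiv e → (x : X) →
                          (HasOtherPoint X x → HasOtherPoint Y (e x)) ×
                          (HasOtherPoint Y (e x) → HasOtherPoint X x)
HasOtherPoint-transport {X} {Y} e ((g , g∘e≡id) , (h , e∘h≡id)) x = forth , back
  where
  forth : HasOtherPoint X x → HasOtherPoint Y (e x)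
  forth (y , y≢x) = e y , λ ey≡ex → y≢x (left-inverse⇒injective g g∘e≡id ey≡ex)
  back : HasOtherPoint Y (e x) → HasOtherPoint X x
  back (y , y≢ex) = h y , λ hy≡x → y≢ex (trans (sym (e∘h≡id y)) (cong e hy≡x))

wem⇒separation : WEM → Separation
wem⇒separation wem = f , invariant , ⊤ , Bool , tt , true , tt≁true
                   , Decidable⇒UIP.≡-irrelevant _≟⊤_ , Decidable⇒UIP.≡-irrelevant _≟_
  where
  f : (X : Set) → X → Bool
  f X x = weakDecision (wem (HasOtherPoint X x))

  invariant : InvariantUnderEquiv f
  invariant X Y e e-equiv x =
    let (forth , back) = HasOtherPoint-transport e e-equiv x
    in weakDecision-⇔ forth back (wem (HasOtherPoint X x)) (wem (HasOtherPoint Y (e x)))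

  -- tt is the only point of ⊤, whereas true : Bool has the other point false.
  f-at-tt : f ⊤ tt ≡ false
  f-at-tt = weakDecision-empty (λ { (tt , tt≢tt) → tt≢tt refl }) (wem _)

  f-at-true : f Bool true ≡ true
  f-at-true = weakDecision-inhabited (false , λ ()) (wem _)

  tt≁true : f ⊤ tt ≢ f Bool true
  tt≁true ft≡fb with trans (sym f-at-tt) (trans ft≡fb f-at-true)
  ... | ()

module _ (T : PropTrunc) where
  open PropTrunc T

  differs-from-⊤⇒wem : (f : (X : Set) → X → Bool) → InvariantUnderEquiv f →
                       (X : Set) (x : X) → isProp (x ≡ x) → f X x ≢ f ⊤ tt → WEM
  differs-from-⊤⇒wem f invariant X x loops-prop fx≢f⊤ A = decide (f Z z ≟ f ⊤ tt)
    where
    Z : Set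
    Z = Σ X λ x' → ∥ (x' ≡ x) ⊎ A ∥

    z : Z
    z = x , ∣ inj₁ refl ∣

    fibre-prop : (x' : X) → isProp ∥ (x' ≡ x) ⊎ A ∥
    fibre-prop _ = ∥∥-isProp

    -- If A holds, Z is equivalent to X, with z corresponding to x.
    value-if-A : A → f Z z ≡ f X x
    value-if-A a = begin
      f Z z                 ≡⟨ cong (f Z) (Σ-prop-path fibre-prop refl _ _) ⟩
      f Z (x , ∣ inj₂ a ∣)  ≡⟨ invariant X Z _ (section-isEquiv fibre-prop (λ _ → ∣ inj₂ a ∣)) x ⟩
      f X x                 ∎
      where open ≡-Reasoning

    -- If ¬ A, every point of Z lies over x, so Z is a singleton.
    value-if-¬A : ¬ A → f Z z ≡ f ⊤ tt
    value-if-¬A ¬a = invariant ⊤ Z (λ _ → z) (singleton-isEquiv z centre) tt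
      where
      over-x : (x' : X) → ∥ (x' ≡ x) ⊎ A ∥ → x' ≡ x
      over-x x' = ∥∥-rec (loops-prop⇒paths-prop loops-prop x')
                         (λ { (inj₁ p) → p ; (inj₂ a) → ⊥-elim (¬a a) })
      centre : (w : Z) → z ≡ w
      centre (x' , t) = Σ-prop-path fibre-prop (sym (over-x x' t)) _ t

    decide : Dec (f Z z ≡ f ⊤ tt) → ¬ A ⊎ ¬ ¬ A
    decide (yes fz≡f⊤) = inj₁ (λ a → fx≢f⊤ (trans (sym (value-if-A a)) fz≡f⊤))
    decide (no  fz≢f⊤) = inj₂ (λ ¬a → fz≢f⊤ (value-if-¬A ¬a))

  separation⇒wem : Separation → WEM
  separation⇒wem (f , invariant , X , Y , x , y , fx≢fy , x-loops , y-loops)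
    with separated⇒differs-from (f ⊤ tt) fx≢fy
  ... | inj₁ fx≢f⊤ = differs-from-⊤⇒wem f invariant X x x-loops fx≢f⊤
  ... | inj₂ fy≢f⊤ = differs-from-⊤⇒wem f invariant Y y y-loops fy≢f⊤

theorem2p9 : PropTrunc →
    (WEM → Σ ((X : Set) → X → Bool) λ f → InvariantUnderEquiv f × Σ Set λ X → Σ Set λ Y → Σ X λ x → Σ Y λ y → (f X x ≢ f Y y) × isProp (x ≡ x) × isProp (y ≡ y))
    × ((Σ ((X : Set) → X → Bool) λ f → InvariantUnderEquiv f × Σ Set λ X → Σ Set λ Y → Σ X λ x → Σ Y λ y → (f X x ≢ f Y y) × isProp (x ≡ x) × isProp (y ≡ y)) → WEM)
theorem2p9 T = wem⇒separation , separation⇒wem T
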